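{- Let $m\neq 0$ and $r$ be real numbers, let $0\le k\le n$, and let $\alpha_0,\alpha_1,\dots$ be real numbers such that $\alpha_0,\dots,\alpha_k$ are pairwise distinct. Then \[ W_{m,r;\overline{\alpha}}(n,k)=\sum_{i=0}^{k}\frac{(r+m\alpha_i)^n}{m^k\prod_{j=0,\,j\neq i}^{k}(\alpha_i-\alpha_j)}. \]
   Context: For a real sequence $\overline{\alpha}=(\alpha_0,\alpha_1,\dots)$ write $(x;\overline{\alpha})_n=\prod_{i=0}^{n-1}(x-\alpha_i)$, with $(x;\overline{\alpha})_0=1$. The generalized $r$-Whitney numbers of the second kind $W_{m,r;\overline{\alpha}}(n,k)$, $0\le k\le n$, are the unique real numbers such that, as polynomials in $x$, \[ (mx+r)^n=\sum_{k=0}^{n}W_{m,r;\overline{\alpha}}(n,k)\,m^k(x;\overline{\alpha})_k . \] -}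

module Defs where

open import Level using (Level; _⊔_) renaming (suc to lsuc)
open import Data.Nat using (ℕ; zero; suc; _≡ᵇ_)
open import Data.Bool using (if_then_else_)
open import Data.List using (List; []; _∷_)
open import Data.List.Relation.Unary.All using (All)
open import Algebra.Bundles using (CommutativeRing)
open import Relation.Nullary using (¬_)

-- A field: a commutative ring with 0 ≠ 1 and a (total) inverse map which is a
-- genuine multiplicative inverse on nonzero elements (the value at 0 is irrelevant).
record Field (c ℓ : Level) : Set (lsuc (c ⊔ ℓ)) where
  field
    commutativeRing : CommutativeRing c ℓ
  open CommutativeRing commutativeRing public
  field
    _⁻¹      : Carrier → Carrier
    0≉1      : ¬ (0# ≈ 1#)
    inverseʳ : ∀ x → ¬ (x ≈ 0#) → (x * (x ⁻¹)) ≈ 1#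

module FieldDefs {c ℓ : Level} (F : Field c ℓ) where
  open Field F

  pow : Carrier → ℕ → Carrier
  pow x zero    = 1#
  pow x (suc n) = pow x n * x

  sumTo : ℕ → (ℕ → Carrier) → Carrier
  sumTo zero    f = 0#
  sumTo (suc n) f = sumTo n f + f n

  prodTo : ℕ → (ℕ → Carrier) → Carrier
  prodTo zero    f = 1#
  prodTo (suc n) f = prodTo n f * f n

  prodExcept : (ℕ → Carrier) → ℕ → ℕ → Carrier
  prodExcept α k i = prodTo (suc k) (λ j → if j ≡ᵇ i then 1# else (α i - α j))

  -- Polynomials over F as coefficient lists, constant term first.
  Poly : Set c
  Poly = List Carrier

  _⊕_ : Poly → Poly → Poly
  []      ⊕ q       = q
  (a ∷ p) ⊕ []      = a ∷ p
  (a ∷ p) ⊕ (b ∷ q) = (a + b) ∷ (p ⊕ q)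

  scale : Carrier → Poly → Poly
  scale c []      = []
  scale c (a ∷ p) = (c * a) ∷ scale c p

  negP : Poly → Poly
  negP []      = []
  negP (a ∷ p) = (- a) ∷ negP p

  mulX : Poly → Poly
  mulX p = 0# ∷ p

  _⊗_ : Poly → Poly → Poly
  []      ⊗ q = []
  (a ∷ p) ⊗ q = scale a q ⊕ mulX (p ⊗ q)

  oneP : Poly
  oneP = 1# ∷ []

  powP : Poly → ℕ → Poly
  powP p zero    = oneP
  powP p (suc n) = powP p n ⊗ p

  _≋_ : Poly → Poly → Set (c ⊔ ℓ)
  p ≋ q = All (λ a → a ≈ 0#) (p ⊕ negP q)

  sumP : ℕ → (ℕ → Poly) → Poly
  sumP zero    f = []
  sumP (suc n) f = sumP n f ⊕ f n

  linP : Carrier → Carrier → Poly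
  linP m r = r ∷ m ∷ []

  fallP : (ℕ → Carrier) → ℕ → Poly
  fallP α zero    = oneP
  fallP α (suc k) = fallP α k ⊗ ((- α k) ∷ 1# ∷ [])

  -- W : ℕ → ℕ → F satisfies the defining identity of the generalized
  -- r-Whitney numbers of the second kind for the given n:
  -- (m x + r)^n = Σ_{k=0}^{n} W(n,k) m^k (x; ᾱ)_k   as polynomials in x.
  IsWhitney₂ : Carrier → Carrier → (ℕ → Carrier) → (ℕ → ℕ → Carrier) → ℕ → Set (c ⊔ ℓ)
  IsWhitney₂ m r α W n =
    powP (linP m r) n ≋ sumP (suc n) (λ k → scale (W n k * pow m k) (fallP α k))

-- Evaluating the defining identity at the nodes writes (r + m x)^n in Newton form with
-- coefficients W(n,j) m^j with respect to α 0, α 1, … . The divided difference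
-- f[α 0, …, α k] = Σ_i f(α i) / Π_{j≠i} (α i - α j) is linear, sends the Newton basis
-- polynomial of degree k to 1 and kills all others (by the recurrence
-- (α (k+1) - α 0) f[α 0, …, α (k+1)] = f[α 1, …, α (k+1)] - f[α 0, …, α k]), so applying it
-- to both sides extracts W(n,k) m^k.
module Submission where

open import Defs
open import Level using (Level)
open import Data.Nat using (ℕ; zero; suc; _≤_; _<_; _≡ᵇ_; z≤n; s≤s)
import Data.Nat.Properties as ℕ
open import Data.Bool using (true; false; T; if_then_else_)
open import Data.Unit using (tt)
open import Data.List using ([]; _∷_)
open import Data.List.Relation.Unary.All using (All; []; _∷_)
open import Data.Empty using (⊥-elim)
open import Function using (_∘_)
open import Relation.Binary.PropositionalEquality using (_≡_; _≢_; subst) renaming (refl to ≡-refl; sym to ≡-sym)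
open import Relation.Binary.Definitions using (tri<; tri≈; tri>)
open import Relation.Nullary using (¬_; yes; no)
import Algebra.Properties.CommutativeSemigroup as CommutativeSemigroupProperties
import Algebra.Properties.Ring as RingProperties
import Relation.Binary.Reasoning.Setoid as SetoidReasoning

module FieldProperties {c ℓ : Level} (F : Field c ℓ) where
  open Field F
  open FieldDefs F
  open RingProperties ring using (x∙y⁻¹≈ε⇒x≈y; ⁻¹-anti-homo‿-)
  open CommutativeSemigroupProperties +-commutativeSemigroup using () renaming (interchange to +-interchange)
  open CommutativeSemigroupProperties *-commutativeSemigroup using () renaming (interchange to *-interchange)
  open SetoidReasoning setoid

  infixl 7 _/_
  _/_ : Carrier → Carrier → Carrier
  x / y = x * y ⁻¹

  x≉y⇒x-y≉0 : ∀ {x y} → x ≉ y → x - y ≉ 0#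
  x≉y⇒x-y≉0 x≉y x-y≈0 = x≉y (x∙y⁻¹≈ε⇒x≈y _ _ x-y≈0)

  inverseˡ : ∀ x → x ≉ 0# → x ⁻¹ * x ≈ 1#
  inverseˡ x x≉0 = trans (*-comm _ _) (inverseʳ x x≉0)

  x≉0⇒x*y≈0⇒y≈0 : ∀ {x y} → x ≉ 0# → x * y ≈ 0# → y ≈ 0#
  x≉0⇒x*y≈0⇒y≈0 {x} {y} x≉0 xy≈0 = begin
    y              ≈⟨ *-identityˡ y ⟨
    1# * y         ≈⟨ *-congʳ (inverseˡ x x≉0) ⟨
    x ⁻¹ * x * y   ≈⟨ *-assoc _ _ _ ⟩
    x ⁻¹ * (x * y) ≈⟨ *-congˡ xy≈0 ⟩
    x ⁻¹ * 0#      ≈⟨ zeroʳ _ ⟩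
    0#             ∎

  x*y≉0 : ∀ {x y} → x ≉ 0# → y ≉ 0# → x * y ≉ 0#
  x*y≉0 x≉0 y≉0 xy≈0 = y≉0 (x≉0⇒x*y≈0⇒y≈0 x≉0 xy≈0)

  inverse-unique : ∀ {x y} → x * y ≈ 1# → y ≈ x ⁻¹
  inverse-unique {x} {y} xy≈1 = begin
    y              ≈⟨ *-identityˡ y ⟨
    1# * y         ≈⟨ *-congʳ (inverseˡ x x≉0) ⟨
    x ⁻¹ * x * y   ≈⟨ *-assoc _ _ _ ⟩
    x ⁻¹ * (x * y) ≈⟨ *-congˡ xy≈1 ⟩
    x ⁻¹ * 1#      ≈⟨ *-identityʳ _ ⟩
    x ⁻¹           ∎
    where
    x≉0 : x ≉ 0#
    x≉0 x≈0 = 0≉1 (trans (sym (zeroˡ y)) (trans (*-congʳ (sym x≈0)) xy≈1))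

  ⁻¹-cong : ∀ {x y} → x ≉ 0# → x ≈ y → x ⁻¹ ≈ y ⁻¹
  ⁻¹-cong {x} x≉0 x≈y = inverse-unique (trans (*-congʳ (sym x≈y)) (inverseʳ x x≉0))

  ⁻¹-distrib-* : ∀ {x y} → x ≉ 0# → y ≉ 0# → (x * y) ⁻¹ ≈ x ⁻¹ * y ⁻¹
  ⁻¹-distrib-* {x} {y} x≉0 y≉0 = sym (inverse-unique (begin
    x * y * (x ⁻¹ * y ⁻¹)     ≈⟨ *-interchange _ _ _ _ ⟩
    x * x ⁻¹ * (y * y ⁻¹)     ≈⟨ *-cong (inverseʳ x x≉0) (inverseʳ y y≉0) ⟩
    1# * 1#                   ≈⟨ *-identityˡ 1# ⟩
    1#                        ∎))

  x*y/y≈x : ∀ x {y} → y ≉ 0# → x * y / y ≈ x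
  x*y/y≈x x {y} y≉0 = begin
    x * y * y ⁻¹   ≈⟨ *-assoc _ _ _ ⟩
    x * (y * y ⁻¹) ≈⟨ *-congˡ (inverseʳ y y≉0) ⟩
    x * 1#         ≈⟨ *-identityʳ x ⟩
    x              ∎

  x/[y*z]≈[x/z]/y : ∀ x {y z} → y ≉ 0# → z ≉ 0# → x / (y * z) ≈ x / z / y
  x/[y*z]≈[x/z]/y x {y} {z} y≉0 z≉0 = begin
    x * (y * z) ⁻¹      ≈⟨ *-congˡ (⁻¹-distrib-* y≉0 z≉0) ⟩
    x * (y ⁻¹ * z ⁻¹)   ≈⟨ *-congˡ (*-comm _ _) ⟩
    x * (z ⁻¹ * y ⁻¹)   ≈⟨ *-assoc _ _ _ ⟨
    x * z ⁻¹ * y ⁻¹     ∎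

  [x*y]/[x*z]≈y/z : ∀ {x} y {z} → x ≉ 0# → z ≉ 0# → (x * y) / (x * z) ≈ y / z
  [x*y]/[x*z]≈y/z {x} y {z} x≉0 z≉0 = begin
    x * y * (x * z) ⁻¹     ≈⟨ *-congˡ (⁻¹-distrib-* x≉0 z≉0) ⟩
    x * y * (x ⁻¹ * z ⁻¹)  ≈⟨ *-interchange _ _ _ _ ⟩
    x * x ⁻¹ * (y * z ⁻¹)  ≈⟨ *-congʳ (inverseʳ x x≉0) ⟩
    1# * (y / z)           ≈⟨ *-identityˡ _ ⟩
    y / z                  ∎

  pow-cong : ∀ n {x y} → x ≈ y → pow x n ≈ pow y n
  pow-cong zero    x≈y = refl
  pow-cong (suc n) x≈y = *-cong (pow-cong n x≈y) x≈y

  pow-≉0 : ∀ n {x} → x ≉ 0# → pow x n ≉ 0#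
  pow-≉0 zero    x≉0 1≈0 = 0≉1 (sym 1≈0)
  pow-≉0 (suc n) x≉0     = x*y≉0 (pow-≉0 n x≉0) x≉0

  [x-y]-[x-z]≈z-y : ∀ x y z → (x - y) - (x - z) ≈ z - y
  [x-y]-[x-z]≈z-y x y z = begin
    (x - y) - (x - z)       ≈⟨ +-congˡ (⁻¹-anti-homo‿- x z) ⟩
    (x - y) + (z - x)       ≈⟨ +-congˡ (+-comm z (- x)) ⟩
    (x - y) + (- x + z)     ≈⟨ +-interchange x (- y) (- x) z ⟩
    (x - x) + (- y + z)     ≈⟨ +-congʳ (-‿inverseʳ x) ⟩
    0# + (- y + z)          ≈⟨ +-identityˡ _ ⟩
    - y + z                 ≈⟨ +-comm (- y) z ⟩
    z - y                   ∎

  [x-x]*y/z≈0 : ∀ x y z → (x - x) * y / z ≈ 0#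
  [x-x]*y/z≈0 x y z = trans (*-congʳ (trans (*-congʳ (-‿inverseʳ x)) (zeroˡ y))) (zeroˡ _)

module FiniteSums {c ℓ : Level} (F : Field c ℓ) where
  open Field F
  open FieldDefs F
  open FieldProperties F
  open RingProperties ring using (-0#≈0#; -‿+-comm)
  open CommutativeSemigroupProperties +-commutativeSemigroup using (interchange)
  open SetoidReasoning setoid

  sumTo-cong : ∀ n {f g} → (∀ i → i < n → f i ≈ g i) → sumTo n f ≈ sumTo n g
  sumTo-cong zero    f≈g = refl
  sumTo-cong (suc n) f≈g =
    +-cong (sumTo-cong n (λ i i<n → f≈g i (ℕ.m<n⇒m<1+n i<n))) (f≈g n (ℕ.n<1+n n))

  sumTo-≈0 : ∀ n f → (∀ i → i < n → f i ≈ 0#) → sumTo n f ≈ 0#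
  sumTo-≈0 zero    f f≈0 = refl
  sumTo-≈0 (suc n) f f≈0 = trans
    (+-cong (sumTo-≈0 n f (λ i i<n → f≈0 i (ℕ.m<n⇒m<1+n i<n))) (f≈0 n (ℕ.n<1+n n)))
    (+-identityʳ 0#)

  sumTo-+ : ∀ n f g → sumTo n (λ i → f i + g i) ≈ sumTo n f + sumTo n g
  sumTo-+ zero    f g = sym (+-identityʳ 0#)
  sumTo-+ (suc n) f g = trans (+-congʳ (sumTo-+ n f g)) (interchange _ _ _ _)

  sumTo-neg : ∀ n f → sumTo n (λ i → - f i) ≈ - sumTo n f
  sumTo-neg zero    f = sym -0#≈0#
  sumTo-neg (suc n) f = trans (+-congʳ (sumTo-neg n f)) (-‿+-comm _ _)

  sumTo-- : ∀ n f g → sumTo n (λ i → f i - g i) ≈ sumTo n f - sumTo n g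
  sumTo-- n f g = trans (sumTo-+ n f (λ i → - g i)) (+-congˡ (sumTo-neg n g))

  sumTo-*ˡ : ∀ n x f → sumTo n (λ i → x * f i) ≈ x * sumTo n f
  sumTo-*ˡ zero    x f = sym (zeroʳ x)
  sumTo-*ˡ (suc n) x f = trans (+-congʳ (sumTo-*ˡ n x f)) (sym (distribˡ x _ _))

  sumTo-*ʳ : ∀ n x f → sumTo n (λ i → f i * x) ≈ sumTo n f * x
  sumTo-*ʳ zero    x f = sym (zeroˡ x)
  sumTo-*ʳ (suc n) x f = trans (+-congʳ (sumTo-*ʳ n x f)) (sym (distribʳ x _ _))

  sumTo-suc-head : ∀ n f → sumTo (suc n) f ≈ f 0 + sumTo n (f ∘ suc)
  sumTo-suc-head zero    f = trans (+-identityˡ _) (sym (+-identityʳ _))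
  sumTo-suc-head (suc n) f = trans (+-congʳ (sumTo-suc-head n f)) (+-assoc _ _ _)

  sumTo-comm : ∀ n m (f : ℕ → ℕ → Carrier) →
    sumTo n (λ i → sumTo m (f i)) ≈ sumTo m (λ j → sumTo n (λ i → f i j))
  sumTo-comm zero    m f = sym (sumTo-≈0 m _ (λ _ _ → refl))
  sumTo-comm (suc n) m f = trans (+-congʳ (sumTo-comm n m f)) (sym (sumTo-+ m _ _))

  sumTo-δ : ∀ n f {k} → k < n → (∀ i → i < n → i ≢ k → f i ≈ 0#) → sumTo n f ≈ f k
  sumTo-δ (suc n) f {k} k<1+n f≈0 with k ℕ.≟ n
  ... | yes ≡-refl = trans
    (+-congʳ (sumTo-≈0 k f (λ i i<k → f≈0 i (ℕ.m<n⇒m<1+n i<k) (ℕ.<⇒≢ i<k))))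
    (+-identityˡ _)
  ... | no k≢n = trans
    (+-cong (sumTo-δ n f (ℕ.≤∧≢⇒< (ℕ.≤-pred k<1+n) k≢n) (λ i i<n → f≈0 i (ℕ.m<n⇒m<1+n i<n)))
            (f≈0 n (ℕ.n<1+n n) (k≢n ∘ ≡-sym)))
    (+-identityʳ _)

  prodTo-suc-head : ∀ n f → prodTo (suc n) f ≈ f 0 * prodTo n (f ∘ suc)
  prodTo-suc-head zero    f = trans (*-identityˡ _) (sym (*-identityʳ _))
  prodTo-suc-head (suc n) f = trans (*-congʳ (prodTo-suc-head n f)) (*-assoc _ _ _)

  prodTo-≉0 : ∀ n f → (∀ i → i < n → f i ≉ 0#) → prodTo n f ≉ 0#
  prodTo-≉0 zero    f f≉0 1≈0 = 0≉1 (sym 1≈0)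
  prodTo-≉0 (suc n) f f≉0 =
    x*y≉0 (prodTo-≉0 n f (λ i i<n → f≉0 i (ℕ.m<n⇒m<1+n i<n))) (f≉0 n (ℕ.n<1+n n))

  prodTo-≈0 : ∀ n f {i} → i < n → f i ≈ 0# → prodTo n f ≈ 0#
  prodTo-≈0 (suc n) f {i} i<1+n fi≈0 with i ℕ.≟ n
  ... | yes ≡-refl = trans (*-congˡ fi≈0) (zeroʳ _)
  ... | no i≢n     = trans (*-congʳ (prodTo-≈0 n f (ℕ.≤∧≢⇒< (ℕ.≤-pred i<1+n) i≢n) fi≈0)) (zeroˡ _)

module DividedDifferences {c ℓ : Level} (F : Field c ℓ) where
  open Field F
  open FieldDefs F
  open FieldProperties F
  open FiniteSums F
  open RingProperties ring using (-0#≈0#; [y-z]x≈yx-zx)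
  open SetoidReasoning setoid

  Distinct : (ℕ → Carrier) → ℕ → Set ℓ
  Distinct β k = ∀ i j → i ≤ k → j ≤ k → i ≢ j → β i ≉ β j

  Distinct-tail : ∀ {β k} → Distinct β (suc k) → Distinct (β ∘ suc) k
  Distinct-tail d i j i≤k j≤k i≢j = d (suc i) (suc j) (s≤s i≤k) (s≤s j≤k) (i≢j ∘ ℕ.suc-injective)

  Distinct-init : ∀ {β k} → Distinct β (suc k) → Distinct β k
  Distinct-init d i j i≤k j≤k = d i j (ℕ.m≤n⇒m≤1+n i≤k) (ℕ.m≤n⇒m≤1+n j≤k)

  -- Chosen so that prodExcept β k i is definitionally prodTo (suc k) (factor β i).
  private
    factor : (ℕ → Carrier) → ℕ → ℕ → Carrier
    factor β i j = if j ≡ᵇ i then 1# else (β i - β j)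

    factor-≢ : ∀ β {i j} → j ≢ i → factor β i j ≡ β i - β j
    factor-≢ β {i} {j} j≢i with j ≡ᵇ i in j≡ᵇi
    ... | true  = ⊥-elim (j≢i (ℕ.≡ᵇ⇒≡ j i (subst T (≡-sym j≡ᵇi) tt)))
    ... | false = ≡-refl

    factor-≉0 : ∀ {β k i j} → Distinct β k → i ≤ k → j ≤ k → factor β i j ≉ 0#
    factor-≉0 {i = i} {j} d i≤k j≤k with j ≡ᵇ i in j≡ᵇi
    ... | true  = λ 1≈0 → 0≉1 (sym 1≈0)
    ... | false = x≉y⇒x-y≉0 (d i j i≤k j≤k (λ i≡j → subst T j≡ᵇi (ℕ.≡⇒≡ᵇ j i (≡-sym i≡j))))

  prodExcept-≉0 : ∀ {β k i} → Distinct β k → i ≤ k → prodExcept β k i ≉ 0#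
  prodExcept-≉0 {k = k} d i≤k =
    prodTo-≉0 (suc k) _ (λ j j<1+k → factor-≉0 d i≤k (ℕ.≤-pred j<1+k))

  prodExcept-suc-head : ∀ β k i →
    prodExcept β (suc k) (suc i) ≈ (β (suc i) - β 0) * prodExcept (β ∘ suc) k i
  prodExcept-suc-head β k i = prodTo-suc-head (suc k) (factor β (suc i))

  prodExcept-suc-last : ∀ β {k i} → i ≤ k →
    prodExcept β (suc k) i ≈ prodExcept β k i * (β i - β (suc k))
  prodExcept-suc-last β i≤k =
    *-congˡ (reflexive (factor-≢ β (ℕ.<⇒≢ (s≤s i≤k) ∘ ≡-sym)))

  divDiff : (ℕ → Carrier) → ℕ → (ℕ → Carrier) → Carrier
  divDiff β k v = sumTo (suc k) (λ i → v i / prodExcept β k i)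

  divDiff-zero : ∀ β v → divDiff β 0 v ≈ v 0
  divDiff-zero β v = trans (+-identityˡ _)
    (trans (*-congˡ (sym (inverse-unique (trans (*-identityʳ _) (*-identityˡ 1#))))) (*-identityʳ _))

  divDiff-cong : ∀ β k {u v} → (∀ i → i ≤ k → u i ≈ v i) → divDiff β k u ≈ divDiff β k v
  divDiff-cong β k u≈v = sumTo-cong (suc k) (λ i i<1+k → *-congʳ (u≈v i (ℕ.≤-pred i<1+k)))

  divDiff-*ˡ : ∀ β k x v → divDiff β k (λ i → x * v i) ≈ x * divDiff β k v
  divDiff-*ˡ β k x v = trans (sumTo-cong (suc k) (λ i _ → *-assoc x (v i) _)) (sumTo-*ˡ (suc k) x _)

  divDiff-- : ∀ β k u v → divDiff β k (λ i → u i - v i) ≈ divDiff β k u - divDiff β k v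
  divDiff-- β k u v = trans
    (sumTo-cong (suc k) (λ i _ → [y-z]x≈yx-zx _ (u i) (v i)))
    (sumTo-- (suc k) _ _)

  divDiff-sumTo : ∀ β k n (f : ℕ → ℕ → Carrier) →
    divDiff β k (λ i → sumTo n (λ j → f j i)) ≈ sumTo n (λ j → divDiff β k (f j))
  divDiff-sumTo β k n f = trans
    (sumTo-cong (suc k) (λ i _ → sym (sumTo-*ʳ n _ (λ j → f j i))))
    (sumTo-comm (suc k) n (λ i j → f j i / prodExcept β k i))

  divDiff-dropHead : ∀ {β k} u → Distinct β (suc k) →
    divDiff β (suc k) (λ i → (β i - β 0) * u i) ≈ divDiff (β ∘ suc) k (u ∘ suc)
  divDiff-dropHead {β} {k} u d = begin
    divDiff β (suc k) (λ i → (β i - β 0) * u i)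
      ≈⟨ sumTo-suc-head (suc k) _ ⟩
    (β 0 - β 0) * u 0 / prodExcept β (suc k) 0 + _
      ≈⟨ +-congʳ ([x-x]*y/z≈0 (β 0) (u 0) _) ⟩
    0# + _
      ≈⟨ +-identityˡ _ ⟩
    sumTo (suc k) (λ i → (β (suc i) - β 0) * u (suc i) / prodExcept β (suc k) (suc i))
      ≈⟨ sumTo-cong (suc k) cancelHead ⟩
    divDiff (β ∘ suc) k (u ∘ suc) ∎
    where
    cancelHead : ∀ i → i < suc k →
      (β (suc i) - β 0) * u (suc i) / prodExcept β (suc k) (suc i) ≈ u (suc i) / prodExcept (β ∘ suc) k i
    cancelHead i i<1+k = trans
      (*-congˡ (⁻¹-cong (prodExcept-≉0 d i<1+k) (prodExcept-suc-head β k i)))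
      ([x*y]/[x*z]≈y/z _ (x≉y⇒x-y≉0 (d (suc i) 0 i<1+k z≤n λ ()))
                         (prodExcept-≉0 (Distinct-tail d) (ℕ.≤-pred i<1+k)))

  divDiff-dropLast : ∀ {β k} u → Distinct β (suc k) →
    divDiff β (suc k) (λ i → (β i - β (suc k)) * u i) ≈ divDiff β k u
  divDiff-dropLast {β} {k} u d = trans
    (+-cong (sumTo-cong (suc k) cancelLast) ([x-x]*y/z≈0 (β (suc k)) (u (suc k)) _))
    (+-identityʳ _)
    where
    cancelLast : ∀ i → i < suc k →
      (β i - β (suc k)) * u i / prodExcept β (suc k) i ≈ u i / prodExcept β k i
    cancelLast i i<1+k = begin
      (β i - β (suc k)) * u i / prodExcept β (suc k) i
        ≈⟨ *-congˡ (⁻¹-cong (prodExcept-≉0 d (ℕ.m≤n⇒m≤1+n i≤k)) (prodExcept-suc-last β i≤k)) ⟩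
      (β i - β (suc k)) * u i / (prodExcept β k i * (β i - β (suc k)))
        ≈⟨ *-congˡ (⁻¹-cong (x*y≉0 (prodExcept-≉0 (Distinct-init d) i≤k) βi-βk+1≉0) (*-comm _ _)) ⟩
      (β i - β (suc k)) * u i / ((β i - β (suc k)) * prodExcept β k i)
        ≈⟨ [x*y]/[x*z]≈y/z (u i) βi-βk+1≉0 (prodExcept-≉0 (Distinct-init d) i≤k) ⟩
      u i / prodExcept β k i ∎
      where
      i≤k = ℕ.≤-pred i<1+k
      βi-βk+1≉0 = x≉y⇒x-y≉0 (d i (suc k) (ℕ.m≤n⇒m≤1+n i≤k) ℕ.≤-refl (ℕ.<⇒≢ i<1+k))

  divDiff-recurrence : ∀ {β k} v → Distinct β (suc k) →
    (β (suc k) - β 0) * divDiff β (suc k) v ≈ divDiff (β ∘ suc) k (v ∘ suc) - divDiff β k v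
  divDiff-recurrence {β} {k} v d = begin
    (β (suc k) - β 0) * divDiff β (suc k) v
      ≈⟨ divDiff-*ˡ β (suc k) _ v ⟨
    divDiff β (suc k) (λ i → (β (suc k) - β 0) * v i)
      ≈⟨ divDiff-cong β (suc k) (λ i _ → splitFactor i) ⟩
    divDiff β (suc k) (λ i → (β i - β 0) * v i - (β i - β (suc k)) * v i)
      ≈⟨ divDiff-- β (suc k) _ _ ⟩
    divDiff β (suc k) (λ i → (β i - β 0) * v i) - divDiff β (suc k) (λ i → (β i - β (suc k)) * v i)
      ≈⟨ +-cong (divDiff-dropHead v d) (-‿cong (divDiff-dropLast v d)) ⟩
    divDiff (β ∘ suc) k (v ∘ suc) - divDiff β k v ∎
    where
    splitFactor : ∀ i → (β (suc k) - β 0) * v i ≈ (β i - β 0) * v i - (β i - β (suc k)) * v i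
    splitFactor i = trans
      (*-congʳ (sym ([x-y]-[x-z]≈z-y (β i) (β 0) (β (suc k)))))
      ([y-z]x≈yx-zx (v i) _ _)

  divDiff-one : ∀ {β} k → Distinct β (suc k) → divDiff β (suc k) (λ _ → 1#) ≈ 0#
  divDiff-one {β} k d = x≉0⇒x*y≈0⇒y≈0
    (x≉y⇒x-y≉0 (d (suc k) 0 ℕ.≤-refl z≤n λ ()))
    (trans (divDiff-recurrence (λ _ → 1#) d) (shiftedDifference k d))
    where
    shiftedDifference : ∀ k → Distinct β (suc k) →
      divDiff (β ∘ suc) k (λ _ → 1#) - divDiff β k (λ _ → 1#) ≈ 0#
    shiftedDifference zero    _ = -‿inverseʳ _
    shiftedDifference (suc k) d = trans
      (+-cong (divDiff-one k (Distinct-tail d)) (-‿cong (divDiff-one k (Distinct-init d))))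
      (trans (+-congˡ -0#≈0#) (+-identityʳ 0#))

  newton : (ℕ → Carrier) → ℕ → Carrier → Carrier
  newton β j x = prodTo j (λ t → x - β t)

  newton-suc-head : ∀ β j x → newton β (suc j) x ≈ (x - β 0) * newton (β ∘ suc) j x
  newton-suc-head β j x = prodTo-suc-head j (λ t → x - β t)

  divDiff-newton-≡ : ∀ {β} k → Distinct β k → divDiff β k (λ i → newton β k (β i)) ≈ 1#
  divDiff-newton-≡ {β} zero    d = divDiff-zero β (λ _ → 1#)
  divDiff-newton-≡ {β} (suc k) d = begin
    divDiff β (suc k) (λ i → newton β (suc k) (β i))
      ≈⟨ divDiff-cong β (suc k) (λ i _ → newton-suc-head β k (β i)) ⟩
    divDiff β (suc k) (λ i → (β i - β 0) * newton (β ∘ suc) k (β i))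
      ≈⟨ divDiff-dropHead _ d ⟩
    divDiff (β ∘ suc) k (λ i → newton (β ∘ suc) k (β (suc i)))
      ≈⟨ divDiff-newton-≡ k (Distinct-tail d) ⟩
    1# ∎

  divDiff-newton-< : ∀ {β j k} → j < k → Distinct β k → divDiff β k (λ i → newton β j (β i)) ≈ 0#
  divDiff-newton-< {j = zero}  {suc k} _ d = divDiff-one k d
  divDiff-newton-< {β} {suc j} {suc k} (s≤s j<k) d = begin
    divDiff β (suc k) (λ i → newton β (suc j) (β i))
      ≈⟨ divDiff-cong β (suc k) (λ i _ → newton-suc-head β j (β i)) ⟩
    divDiff β (suc k) (λ i → (β i - β 0) * newton (β ∘ suc) j (β i))
      ≈⟨ divDiff-dropHead _ d ⟩
    divDiff (β ∘ suc) k (λ i → newton (β ∘ suc) j (β (suc i)))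
      ≈⟨ divDiff-newton-< j<k (Distinct-tail d) ⟩
    0# ∎

  divDiff-newton-> : ∀ {β j k} → k < j → divDiff β k (λ i → newton β j (β i)) ≈ 0#
  divDiff-newton-> {β} {j} {k} k<j = sumTo-≈0 (suc k) _ (λ i i<1+k → trans
    (*-congʳ (prodTo-≈0 j _ (ℕ.≤-trans i<1+k k<j) (-‿inverseʳ (β i))))
    (zeroˡ _))

  divDiff-newtonExpansion : ∀ {β k n} (a : ℕ → Carrier) → k < n → Distinct β k →
    divDiff β k (λ i → sumTo n (λ j → a j * newton β j (β i))) ≈ a k
  divDiff-newtonExpansion {β} {k} {n} a k<n d = begin
    divDiff β k (λ i → sumTo n (λ j → a j * newton β j (β i)))
      ≈⟨ divDiff-sumTo β k n _ ⟩
    sumTo n (λ j → divDiff β k (λ i → a j * newton β j (β i)))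
      ≈⟨ sumTo-cong n (λ j _ → divDiff-*ˡ β k (a j) _) ⟩
    sumTo n (λ j → a j * divDiff β k (λ i → newton β j (β i)))
      ≈⟨ sumTo-δ n _ k<n offDiagonal ⟩
    a k * divDiff β k (λ i → newton β k (β i))
      ≈⟨ *-congˡ (divDiff-newton-≡ k d) ⟩
    a k * 1#
      ≈⟨ *-identityʳ (a k) ⟩
    a k ∎
    where
    offDiagonal : ∀ j → j < n → j ≢ k → a j * divDiff β k (λ i → newton β j (β i)) ≈ 0#
    offDiagonal j _ j≢k with ℕ.<-cmp j k
    ... | tri< j<k _ _ = trans (*-congˡ (divDiff-newton-< j<k d)) (zeroʳ _)
    ... | tri≈ _ j≡k _ = ⊥-elim (j≢k j≡k)
    ... | tri> _ _ k<j = trans (*-congˡ (divDiff-newton-> k<j)) (zeroʳ _)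

module PolynomialEvaluation {c ℓ : Level} (F : Field c ℓ) where
  open Field F
  open FieldDefs F
  open DividedDifferences F using (newton)
  open RingProperties ring using (x∙y⁻¹≈ε⇒x≈y; -0#≈0#; -‿+-comm; -‿distribʳ-*)
  open CommutativeSemigroupProperties +-commutativeSemigroup using () renaming (interchange to +-interchange)
  open CommutativeSemigroupProperties *-commutativeSemigroup using (x∙yz≈y∙xz)
  open SetoidReasoning setoid

  eval : Poly → Carrier → Carrier
  eval []      x = 0#
  eval (a ∷ p) x = a + x * eval p x

  eval-⊕ : ∀ p q x → eval (p ⊕ q) x ≈ eval p x + eval q x
  eval-⊕ []      q       x = sym (+-identityˡ _)
  eval-⊕ (a ∷ p) []      x = sym (+-identityʳ _)
  eval-⊕ (a ∷ p) (b ∷ q) x = begin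
    (a + b) + x * eval (p ⊕ q) x          ≈⟨ +-congˡ (*-congˡ (eval-⊕ p q x)) ⟩
    (a + b) + x * (eval p x + eval q x)   ≈⟨ +-congˡ (distribˡ x _ _) ⟩
    (a + b) + (x * eval p x + x * eval q x) ≈⟨ +-interchange _ _ _ _ ⟩
    (a + x * eval p x) + (b + x * eval q x) ∎

  eval-scale : ∀ a p x → eval (scale a p) x ≈ a * eval p x
  eval-scale a []      x = sym (zeroʳ a)
  eval-scale a (b ∷ p) x = begin
    a * b + x * eval (scale a p) x ≈⟨ +-congˡ (*-congˡ (eval-scale a p x)) ⟩
    a * b + x * (a * eval p x)     ≈⟨ +-congˡ (x∙yz≈y∙xz x a _) ⟩
    a * b + a * (x * eval p x)     ≈⟨ distribˡ a _ _ ⟨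
    a * (b + x * eval p x)         ∎

  eval-negP : ∀ p x → eval (negP p) x ≈ - eval p x
  eval-negP []      x = sym -0#≈0#
  eval-negP (a ∷ p) x = begin
    - a + x * eval (negP p) x ≈⟨ +-congˡ (*-congˡ (eval-negP p x)) ⟩
    - a + x * - eval p x      ≈⟨ +-congˡ (-‿distribʳ-* x _) ⟨
    - a + - (x * eval p x)    ≈⟨ -‿+-comm _ _ ⟩
    - (a + x * eval p x)      ∎

  eval-⊗ : ∀ p q x → eval (p ⊗ q) x ≈ eval p x * eval q x
  eval-⊗ []      q x = sym (zeroˡ _)
  eval-⊗ (a ∷ p) q x = begin
    eval (scale a q ⊕ mulX (p ⊗ q)) x         ≈⟨ eval-⊕ (scale a q) (mulX (p ⊗ q)) x ⟩
    eval (scale a q) x + (0# + x * eval (p ⊗ q) x) ≈⟨ +-cong (eval-scale a q x) (+-identityˡ _) ⟩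
    a * eval q x + x * eval (p ⊗ q) x         ≈⟨ +-congˡ (*-congˡ (eval-⊗ p q x)) ⟩
    a * eval q x + x * (eval p x * eval q x)  ≈⟨ +-congˡ (*-assoc _ _ _) ⟨
    a * eval q x + x * eval p x * eval q x    ≈⟨ distribʳ _ _ _ ⟨
    (a + x * eval p x) * eval q x             ∎

  eval-const : ∀ a x → eval (a ∷ []) x ≈ a
  eval-const a x = trans (+-congˡ (zeroʳ x)) (+-identityʳ a)

  eval-powP : ∀ p n x → eval (powP p n) x ≈ pow (eval p x) n
  eval-powP p zero    x = eval-const 1# x
  eval-powP p (suc n) x = trans (eval-⊗ (powP p n) p x) (*-congʳ (eval-powP p n x))

  eval-sumP : ∀ n f x → eval (sumP n f) x ≈ sumTo n (λ j → eval (f j) x)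
  eval-sumP zero    f x = refl
  eval-sumP (suc n) f x = trans (eval-⊕ (sumP n f) (f n) x) (+-congʳ (eval-sumP n f x))

  eval-linP : ∀ m r x → eval (linP m r) x ≈ r + m * x
  eval-linP m r x = +-congˡ (trans (*-congˡ (eval-const m x)) (*-comm x m))

  eval-fallP : ∀ α k x → eval (fallP α k) x ≈ newton α k x
  eval-fallP α zero    x = eval-const 1# x
  eval-fallP α (suc k) x = trans (eval-⊗ (fallP α k) _ x) (*-cong (eval-fallP α k x) (begin
    - α k + x * (1# + x * 0#) ≈⟨ +-congˡ (*-congˡ (eval-const 1# x)) ⟩
    - α k + x * 1#            ≈⟨ +-congˡ (*-identityʳ x) ⟩
    - α k + x                 ≈⟨ +-comm _ _ ⟩
    x - α k                   ∎))

  eval-≋ : ∀ p q x → p ≋ q → eval p x ≈ eval q x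
  eval-≋ p q x p-q≈0 = x∙y⁻¹≈ε⇒x≈y _ _ (begin
    eval p x - eval q x          ≈⟨ +-congˡ (eval-negP q x) ⟨
    eval p x + eval (negP q) x   ≈⟨ eval-⊕ p (negP q) x ⟨
    eval (p ⊕ negP q) x          ≈⟨ eval-≈0 (p ⊕ negP q) p-q≈0 ⟩
    0#                           ∎)
    where
    eval-≈0 : ∀ r → All (_≈ 0#) r → eval r x ≈ 0#
    eval-≈0 []      []          = refl
    eval-≈0 (a ∷ r) (a≈0 ∷ r≈0) =
      trans (+-cong a≈0 (trans (*-congˡ (eval-≈0 r r≈0)) (zeroʳ x))) (+-identityʳ 0#)

module WhitneyNumbers {c ℓ : Level} (F : Field c ℓ) where
  open Field F
  open FieldDefs F
  open FieldProperties F using (pow-cong)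
  open FiniteSums F
  open DividedDifferences F using (newton)
  open PolynomialEvaluation F
  open SetoidReasoning setoid

  IsWhitney₂⇒newtonForm : ∀ m r α W n → IsWhitney₂ m r α W n → ∀ x →
    pow (r + m * x) n ≈ sumTo (suc n) (λ j → W n j * pow m j * newton α j x)
  IsWhitney₂⇒newtonForm m r α W n whitney x = begin
    pow (r + m * x) n
      ≈⟨ pow-cong n (eval-linP m r x) ⟨
    pow (eval (linP m r) x) n
      ≈⟨ eval-powP (linP m r) n x ⟨
    eval (powP (linP m r) n) x
      ≈⟨ eval-≋ (powP (linP m r) n) _ x whitney ⟩
    eval (sumP (suc n) (λ j → scale (W n j * pow m j) (fallP α j))) x
      ≈⟨ eval-sumP (suc n) _ x ⟩
    sumTo (suc n) (λ j → eval (scale (W n j * pow m j) (fallP α j)) x)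
      ≈⟨ sumTo-cong (suc n) (λ j _ → eval-scale _ (fallP α j) x) ⟩
    sumTo (suc n) (λ j → W n j * pow m j * eval (fallP α j) x)
      ≈⟨ sumTo-cong (suc n) (λ j _ → *-congˡ (eval-fallP α j x)) ⟩
    sumTo (suc n) (λ j → W n j * pow m j * newton α j x) ∎

mainTheorem3 : {c ℓ : Level} (F : Field c ℓ) →
    let open Field F
        open FieldDefs F
    in
    (m r : Carrier) → ¬ (m ≈ 0#) →
    (α : ℕ → Carrier) (W : ℕ → ℕ → Carrier) (n k : ℕ) → k ≤ n →
    (∀ i j → i ≤ k → j ≤ k → i ≢ j → ¬ (α i ≈ α j)) →
    IsWhitney₂ m r α W n →
    W n k ≈ sumTo (suc k)
      (λ i → pow (r + m * α i) n * ((pow m k * prodExcept α k i) ⁻¹))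
mainTheorem3 F m r m≉0 α W n k k≤n distinct whitney = begin
  W n k
    ≈⟨ x*y/y≈x (W n k) mᵏ≉0 ⟨
  W n k * pow m k / pow m k
    ≈⟨ *-congʳ (divDiff-newtonExpansion (λ j → W n j * pow m j) (s≤s k≤n) distinct) ⟨
  divDiff α k (λ i → sumTo (suc n) (λ j → W n j * pow m j * newton α j (α i))) / pow m k
    ≈⟨ *-congʳ (divDiff-cong α k (λ i _ → IsWhitney₂⇒newtonForm m r α W n whitney (α i))) ⟨
  divDiff α k (λ i → pow (r + m * α i) n) / pow m k
    ≈⟨ sumTo-*ʳ (suc k) _ _ ⟨
  sumTo (suc k) (λ i → pow (r + m * α i) n / prodExcept α k i / pow m k)
    ≈⟨ sumTo-cong (suc k) (λ i i≤k → x/[y*z]≈[x/z]/y _ mᵏ≉0 (prodExcept-≉0 distinct (ℕ.≤-pred i≤k))) ⟨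
  sumTo (suc k) (λ i → pow (r + m * α i) n / (pow m k * prodExcept α k i)) ∎
  where
  open Field F
  open FieldDefs F
  open FieldProperties F
  open FiniteSums F
  open DividedDifferences F
  open WhitneyNumbers F
  open SetoidReasoning setoid
  mᵏ≉0 = pow-≉0 k m≉0
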